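{- Let $n\geq 2$, $1\leq m\leq n-1$, $G=\mathrm{Sym}(\{1,\dots,n\})=S_n$ and $A=\mathrm{Sym}(\{1,\dots,m\})\times\mathrm{Sym}(\{m+1,\dots,n\})\cong S_m\times S_{n-m}$. Then $A$ is a perfect code of $G$.
   Context: Graphs are finite, undirected and simple; a subset $C$ of the vertex set $V$ of a graph is a perfect code if every vertex in $V\setminus C$ is adjacent to exactly one vertex of $C$. For a group $G$ and an inverse-closed $S\subseteq G\setminus\{e\}$, the Cayley graph $\mathrm{Cay}(G,S)$ has vertex set $G$ and edges $\{g,sg\}$ ($s\in S$, $g\in G$); a subset of $G$ is a perfect code of $G$ if it is a perfect code in some Cayley graph of $G$. -}

module Defs where

open import Data.Nat using (ℕ; _<_)
open import Data.Fin using (Fin; toℕ)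
open import Data.Fin.Permutation using (Permutation′; _⟨$⟩ʳ_; _∘ₚ_; flip; id; _≈_)
open import Data.Product using (Σ; ∃; _×_; _,_)
open import Relation.Nullary using (¬_)
open import Relation.Unary using (Pred; _∈_; _∉_)
open import Function.Bundles using (_⇔_)
open import Level using (0ℓ)

-- The symmetric group S_n = Sym(Fin n); Fin n = {0,…,n-1} stands for {1,…,n}.
-- Elements are permutations, equality is pointwise (_≈_).
Sym : ℕ → Set
Sym n = Permutation′ n

-- Group product (s · g)(x) = s (g x), i.e. composition of functions.
-- (_∘ₚ_ is diagrammatic: (g ∘ₚ s) applies g first, then s.)
_·_ : ∀ {n} → Sym n → Sym n → Sym n
s · g = g ∘ₚ s

_⁻¹ : ∀ {n} → Sym n → Sym n
g ⁻¹ = flip g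

e : ∀ {n} → Sym n
e = id

RespectsEq : ∀ {n} → Pred (Sym n) 0ℓ → Set
RespectsEq {n} P = ∀ {g h : Sym n} → g ≈ h → P g → P h

IsConnectionSet : ∀ {n} → Pred (Sym n) 0ℓ → Set
IsConnectionSet {n} S =
  RespectsEq S × (∀ s → s ∈ S → (s ⁻¹) ∈ S) × (∀ s → s ∈ S → ¬ (s ≈ e))

Adj : ∀ {n} → Pred (Sym n) 0ℓ → Sym n → Sym n → Set
Adj S g h = Σ _ λ s → s ∈ S × (h ≈ (s · g))

IsPerfectCodeIn : ∀ {n} → Pred (Sym n) 0ℓ → Pred (Sym n) 0ℓ → Set
IsPerfectCodeIn {n} S C =
  ∀ (v : Sym n) → v ∉ C →
    Σ (Sym n) λ c → c ∈ C × Adj S c v × (∀ c′ → c′ ∈ C → Adj S c′ v → c′ ≈ c)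

IsPerfectCodeOf : ∀ {n} → Pred (Sym n) 0ℓ → Set₁
IsPerfectCodeOf {n} C =
  Σ (Pred (Sym n) 0ℓ) λ S → IsConnectionSet S × IsPerfectCodeIn S C

-- A = Sym({1..m}) × Sym({m+1..n}): permutations mapping the first m points
-- (indices 0..m-1) into themselves and the rest into the rest.
YoungSub : ∀ {n} → ℕ → Pred (Sym n) 0ℓ
YoungSub {n} m g = ∀ (i : Fin n) → (toℕ i < m) ⇔ (toℕ (g ⟨$⟩ʳ i) < m)

-- Suppose every v ∈ Sym n is carried into C by an involution σ v (σ v · v ∈ C) that is
-- determined by the coset of v: σ w · v ∈ C implies σ v = σ w. Then S = {σ v | v ∉ C} is
-- inverse-closed and misses e, and in Cay(Sym n, S) the only neighbour in C of a vertex
-- v ∉ C is σ v · v.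
-- For the setwise stabiliser C of Y ⊆ Fin n (for Y = {1..m}, C = Sym {1..m} × Sym {m+1..n})
-- the coset of v is determined by v(Y), and σ v can be taken to be the involution exchanging,
-- in increasing order, the elements of v(Y) ∖ Y with those of Y ∖ v(Y); these two sets have
-- the same size because |v(Y)| = |Y|.
module Submission where

open import Defs
open import Data.Bool.Base using (Bool; true; false; if_then_else_)
open import Data.Empty using (⊥-elim)
open import Data.Fin.Base using (Fin; zero; suc; cast; toℕ)
open import Data.Fin.Permutation using (Permutation′; permutation; _⟨$⟩ʳ_; _⟨$⟩ˡ_; inverseˡ; inverseʳ; _≈_)
open import Data.Fin.Properties using (cast-involutive)
open import Data.Fin.Subset using (Subset; inside; outside; _∈_; _∉_; ∣_∣; _∩_; _─_)
open import Data.Fin.Subset.Properties using (_∈?_; drop-there; ∩-comm; x∈p∧x∉q⇒x∈p─q; p─q⊆p; ⊆-antisym)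
open import Data.Nat.Base using (ℕ; zero; suc; _+_; _≤_; _∸_)
open import Data.Nat.Properties using (+-suc; +-cancelˡ-≡; _<?_; +-0-commutativeMonoid)
open import Algebra.Properties.CommutativeMonoid.Sum +-0-commutativeMonoid using (sum; sum-permute)
open import Data.Product.Base using (∃; _×_; _,_)
open import Data.Vec.Base using ([]; _∷_; here; there; tabulate)
open import Function.Base using (_∘_)
open import Function.Bundles using (_⇔_; mk⇔; Equivalence)
open import Function.Properties.Equivalence using (⇔-setoid)
open import Level using (Level; 0ℓ)
open import Relation.Binary.PropositionalEquality
import Relation.Binary.Reasoning.Setoid as ≈-Reasoning
open import Relation.Nullary using (¬_; yes; no; does; contradiction)
open import Relation.Unary using (Pred; Decidable)

private variable
  ℓ : Level
  n : ℕ
  x : Fin n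
  p q : Subset n

record InvolutiveTransversal (C : Pred (Sym n) 0ℓ) : Set where
  field
    σ : Sym n → Sym n
    σ-involutive : ∀ v → σ v · σ v ≈ e
    σ·v∈C : ∀ v → C (σ v · v)
    σ-unique : ∀ v w → C (σ w · v) → σ v ≈ σ w

module _ {C : Pred (Sym n) 0ℓ} (T : InvolutiveTransversal C) (C-respects : RespectsEq C) where
  open InvolutiveTransversal T

  transversal : Pred (Sym n) 0ℓ
  transversal s = ∃ λ v → ¬ C v × s ≈ σ v

  transversal-isConnectionSet : IsConnectionSet transversal
  transversal-isConnectionSet = (λ {g h} → respects {g} {h}) , inverse-closed , ≉e
    where
    open ≡-Reasoning

    respects : RespectsEq transversal
    respects g≈h (v , v∉C , g≈σv) = v , v∉C , λ i → trans (sym (g≈h i)) (g≈σv i)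

    inverse-closed : ∀ s → transversal s → transversal (s ⁻¹)
    inverse-closed s (v , v∉C , s≈σv) = v , v∉C , λ i → begin
      s ⟨$⟩ˡ i                        ≡⟨ cong (s ⟨$⟩ˡ_) (σ-involutive v i) ⟨
      s ⟨$⟩ˡ (σ v ⟨$⟩ʳ (σ v ⟨$⟩ʳ i))  ≡⟨ cong (s ⟨$⟩ˡ_) (s≈σv _) ⟨
      s ⟨$⟩ˡ (s ⟨$⟩ʳ (σ v ⟨$⟩ʳ i))    ≡⟨ inverseˡ s ⟩
      σ v ⟨$⟩ʳ i                      ∎

    ≉e : ∀ s → transversal s → ¬ (s ≈ e)
    ≉e s (v , v∉C , s≈σv) s≈e =
      v∉C (C-respects (λ i → trans (sym (s≈σv (v ⟨$⟩ʳ i))) (s≈e _)) (σ·v∈C v))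

  transversal-isPerfectCode : IsPerfectCodeIn transversal C
  transversal-isPerfectCode v v∉C =
    σ v · v , σ·v∈C v , (σ v , (v , v∉C , λ _ → refl) , λ i → sym (σ-involutive v (v ⟨$⟩ʳ i))) , unique
    where
    unique : ∀ c → C c → Adj transversal c v → c ≈ σ v · v
    unique c c∈C (s , (w , _ , s≈σw) , v≈s·c) i =
      trans (c≈σw·v i) (sym (σ-unique v w (C-respects c≈σw·v c∈C) (v ⟨$⟩ʳ i)))
      where
      c≈σw·v : c ≈ σ w · v
      c≈σw·v i = begin
        c ⟨$⟩ʳ i                        ≡⟨ σ-involutive w _ ⟨
        σ w ⟨$⟩ʳ (σ w ⟨$⟩ʳ (c ⟨$⟩ʳ i))  ≡⟨ cong (σ w ⟨$⟩ʳ_) (s≈σw _) ⟨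
        σ w ⟨$⟩ʳ (s ⟨$⟩ʳ (c ⟨$⟩ʳ i))    ≡⟨ cong (σ w ⟨$⟩ʳ_) (v≈s·c i) ⟨
        σ w ⟨$⟩ʳ (v ⟨$⟩ʳ i)             ∎
        where open ≡-Reasoning

  involutiveTransversal⇒perfectCode : IsPerfectCodeOf C
  involutiveTransversal⇒perfectCode = transversal , transversal-isConnectionSet , transversal-isPerfectCode

select : (p : Subset n) → Fin ∣ p ∣ → Fin n
select (inside ∷ p) zero = zero
select (inside ∷ p) (suc r) = suc (select p r)
select (outside ∷ p) r = suc (select p r)

rank : (p : Subset n) (x : Fin n) → .(x ∈ p) → Fin ∣ p ∣
rank (inside ∷ p) zero _ = zero
rank (inside ∷ p) (suc x) x∈p = suc (rank p x (drop-there x∈p))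
rank (outside ∷ p) zero ()
rank (outside ∷ p) (suc x) x∈p = rank p x (drop-there x∈p)

select-∈ : (p : Subset n) (r : Fin ∣ p ∣) → select p r ∈ p
select-∈ (inside ∷ p) zero = here
select-∈ (inside ∷ p) (suc r) = there (select-∈ p r)
select-∈ (outside ∷ p) r = there (select-∈ p r)

select-rank : (p : Subset n) (x : Fin n) .(x∈p : x ∈ p) → select p (rank p x x∈p) ≡ x
select-rank (inside ∷ p) zero _ = refl
select-rank (inside ∷ p) (suc x) x∈p = cong suc (select-rank p x (drop-there x∈p))
select-rank (outside ∷ p) zero ()
select-rank (outside ∷ p) (suc x) x∈p = cong suc (select-rank p x (drop-there x∈p))

rank-select : (p : Subset n) (r : Fin ∣ p ∣) .(r∈p : select p r ∈ p) → rank p (select p r) r∈p ≡ r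
rank-select (inside ∷ p) zero _ = refl
rank-select (inside ∷ p) (suc r) r∈p = cong suc (rank-select p r (drop-there r∈p))
rank-select (outside ∷ p) r r∈p = rank-select p r (drop-there r∈p)

match : (p q : Subset n) → .(∣ p ∣ ≡ ∣ q ∣) → (x : Fin n) → .(x ∈ p) → Fin n
match p q ∣p∣≡∣q∣ x x∈p = select q (cast ∣p∣≡∣q∣ (rank p x x∈p))

match-∈ : (p q : Subset n) .(∣p∣≡∣q∣ : ∣ p ∣ ≡ ∣ q ∣) (x : Fin n) .(x∈p : x ∈ p) →
          match p q ∣p∣≡∣q∣ x x∈p ∈ q
match-∈ p q _ _ _ = select-∈ q _

match-inverse : (p q : Subset n) .(∣p∣≡∣q∣ : ∣ p ∣ ≡ ∣ q ∣) (x : Fin n) .(x∈p : x ∈ p) →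
                match q p (sym ∣p∣≡∣q∣) (match p q ∣p∣≡∣q∣ x x∈p) (match-∈ p q ∣p∣≡∣q∣ x x∈p) ≡ x
match-inverse p q ∣p∣≡∣q∣ x x∈p = begin
  select p (cast (sym ∣p∣≡∣q∣) (rank q (select q (cast ∣p∣≡∣q∣ r)) (select-∈ q _)))
    ≡⟨ cong (select p ∘ cast (sym ∣p∣≡∣q∣)) (rank-select q _ (select-∈ q _)) ⟩
  select p (cast (sym ∣p∣≡∣q∣) (cast ∣p∣≡∣q∣ r))
    ≡⟨ cong (select p) (cast-involutive (sym ∣p∣≡∣q∣) ∣p∣≡∣q∣ r) ⟩
  select p r
    ≡⟨ select-rank p x x∈p ⟩
  x ∎
  where
  open ≡-Reasoning
  r = rank p x x∈p

∣p∣≡∣p∩q∣+∣p─q∣ : (p q : Subset n) → ∣ p ∣ ≡ ∣ p ∩ q ∣ + ∣ p ─ q ∣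
∣p∣≡∣p∩q∣+∣p─q∣ [] [] = refl
∣p∣≡∣p∩q∣+∣p─q∣ (inside ∷ p) (inside ∷ q) = cong suc (∣p∣≡∣p∩q∣+∣p─q∣ p q)
∣p∣≡∣p∩q∣+∣p─q∣ (inside ∷ p) (outside ∷ q) = trans (cong suc (∣p∣≡∣p∩q∣+∣p─q∣ p q)) (sym (+-suc _ _))
∣p∣≡∣p∩q∣+∣p─q∣ (outside ∷ p) (inside ∷ q) = ∣p∣≡∣p∩q∣+∣p─q∣ p q
∣p∣≡∣p∩q∣+∣p─q∣ (outside ∷ p) (outside ∷ q) = ∣p∣≡∣p∩q∣+∣p─q∣ p q

∣p∣≡∣q∣⇒∣p─q∣≡∣q─p∣ : (p q : Subset n) → ∣ p ∣ ≡ ∣ q ∣ → ∣ p ─ q ∣ ≡ ∣ q ─ p ∣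
∣p∣≡∣q∣⇒∣p─q∣≡∣q─p∣ p q ∣p∣≡∣q∣ = +-cancelˡ-≡ ∣ p ∩ q ∣ _ _ (begin
  ∣ p ∩ q ∣ + ∣ p ─ q ∣  ≡⟨ ∣p∣≡∣p∩q∣+∣p─q∣ p q ⟨
  ∣ p ∣                  ≡⟨ ∣p∣≡∣q∣ ⟩
  ∣ q ∣                  ≡⟨ ∣p∣≡∣p∩q∣+∣p─q∣ q p ⟩
  ∣ q ∩ p ∣ + ∣ q ─ p ∣  ≡⟨ cong (λ r → ∣ r ∣ + ∣ q ─ p ∣) (∩-comm q p) ⟩
  ∣ p ∩ q ∣ + ∣ q ─ p ∣  ∎)
  where open ≡-Reasoning

x∈p─q⇒x∉q : x ∈ p ─ q → x ∉ q
x∈p─q⇒x∉q {p = _ ∷ _} {q = outside ∷ _} (there x∈p─q) (there x∈q) = x∈p─q⇒x∉q x∈p─q x∈q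
x∈p─q⇒x∉q {p = _ ∷ _} {q = inside ∷ _} (there x∈p─q) (there x∈q) = x∈p─q⇒x∉q x∈p─q x∈q

module Exchange (X Y : Subset n) .(∣X─Y∣≡∣Y─X∣ : ∣ X ─ Y ∣ ≡ ∣ Y ─ X ∣) where

  forward : (x : Fin n) → .(x ∈ X ─ Y) → Fin n
  forward = match (X ─ Y) (Y ─ X) ∣X─Y∣≡∣Y─X∣

  backward : (x : Fin n) → .(x ∈ Y ─ X) → Fin n
  backward = match (Y ─ X) (X ─ Y) (sym ∣X─Y∣≡∣Y─X∣)

  exchange : Fin n → Fin n
  exchange x with x ∈? X | x ∈? Y
  ... | yes x∈X | no x∉Y = forward x (x∈p∧x∉q⇒x∈p─q x∈X x∉Y)
  ... | no x∉X | yes x∈Y = backward x (x∈p∧x∉q⇒x∈p─q x∈Y x∉X)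
  ... | yes _ | yes _ = x
  ... | no _ | no _ = x

  exchange-X─Y : (x∈X : x ∈ X) (x∉Y : x ∉ Y) → exchange x ≡ forward x (x∈p∧x∉q⇒x∈p─q x∈X x∉Y)
  exchange-X─Y {x = x} x∈X x∉Y with x ∈? X | x ∈? Y
  ... | yes _ | no _ = refl
  ... | yes _ | yes x∈Y = contradiction x∈Y x∉Y
  ... | no x∉X | _ = contradiction x∈X x∉X

  exchange-Y─X : (x∉X : x ∉ X) (x∈Y : x ∈ Y) → exchange x ≡ backward x (x∈p∧x∉q⇒x∈p─q x∈Y x∉X)
  exchange-Y─X {x = x} x∉X x∈Y with x ∈? X | x ∈? Y
  ... | no _ | yes _ = refl
  ... | no _ | no x∉Y = contradiction x∈Y x∉Y
  ... | yes x∈X | _ = contradiction x∈X x∉X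

  exchange-fixed : x ∈ X ⇔ x ∈ Y → exchange x ≡ x
  exchange-fixed {x = x} x∈X⇔x∈Y with x ∈? X | x ∈? Y
  ... | yes x∈X | no x∉Y = contradiction (Equivalence.to x∈X⇔x∈Y x∈X) x∉Y
  ... | no x∉X | yes x∈Y = contradiction (Equivalence.from x∈X⇔x∈Y x∈Y) x∉X
  ... | yes _ | yes _ = refl
  ... | no _ | no _ = refl

  exchange-involutive : ∀ x → exchange (exchange x) ≡ x
  exchange-involutive x with x ∈? X | x ∈? Y
  ... | yes x∈X | no x∉Y =
    trans (exchange-Y─X (x∈p─q⇒x∉q y∈Y─X) (p─q⊆p Y X y∈Y─X)) (match-inverse (X ─ Y) (Y ─ X) _ x _)
    where y∈Y─X = match-∈ (X ─ Y) (Y ─ X) _ x _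
  ... | no x∉X | yes x∈Y =
    trans (exchange-X─Y (p─q⊆p X Y y∈X─Y) (x∈p─q⇒x∉q y∈X─Y)) (match-inverse (Y ─ X) (X ─ Y) _ x _)
    where y∈X─Y = match-∈ (Y ─ X) (X ─ Y) _ x _
  ... | yes x∈X | yes x∈Y = exchange-fixed (mk⇔ (λ _ → x∈Y) (λ _ → x∈X))
  ... | no x∉X | no x∉Y = exchange-fixed (mk⇔ (⊥-elim ∘ x∉X) (⊥-elim ∘ x∉Y))

  ∈X⇔exchange∈Y : x ∈ X ⇔ exchange x ∈ Y
  ∈X⇔exchange∈Y {x = x} with x ∈? X | x ∈? Y
  ... | yes x∈X | no x∉Y = mk⇔ (λ _ → p─q⊆p Y X (match-∈ (X ─ Y) (Y ─ X) _ x _)) (λ _ → x∈X)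
  ... | no x∉X | yes x∈Y = mk⇔ (⊥-elim ∘ x∉X) (⊥-elim ∘ x∈p─q⇒x∉q (match-∈ (Y ─ X) (X ─ Y) _ x _))
  ... | yes x∈X | yes x∈Y = mk⇔ (λ _ → x∈Y) (λ _ → x∈X)
  ... | no x∉X | no x∉Y = mk⇔ (⊥-elim ∘ x∉X) (⊥-elim ∘ x∉Y)

  exchangeₚ : Permutation′ n
  exchangeₚ = permutation exchange exchange exchange-involutive exchange-involutive

exchange-cong : ∀ {X X′ Y : Subset n}
                .{∣X─Y∣≡∣Y─X∣ : ∣ X ─ Y ∣ ≡ ∣ Y ─ X ∣} .{∣X′─Y∣≡∣Y─X′∣ : ∣ X′ ─ Y ∣ ≡ ∣ Y ─ X′ ∣} → X ≡ X′ →
                ∀ x → Exchange.exchange X Y ∣X─Y∣≡∣Y─X∣ x ≡ Exchange.exchange X′ Y ∣X′─Y∣≡∣Y─X′∣ x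
exchange-cong refl x = refl

toSubset : {P : Pred (Fin n) ℓ} → Decidable P → Subset n
toSubset P? = tabulate (does ∘ P?)

∈-toSubset : {P : Pred (Fin n) ℓ} (P? : Decidable P) → x ∈ toSubset P? ⇔ P x
∈-toSubset {x = zero} P? with P? zero
... | yes Px = mk⇔ (λ _ → Px) (λ _ → here)
... | no ¬Px = mk⇔ (λ ()) (⊥-elim ∘ ¬Px)
∈-toSubset {x = suc x} P? = mk⇔ (to ∘ drop-there) (there ∘ from)
  where open Equivalence (∈-toSubset (P? ∘ suc))

∣tabulate∣≡sum : (f : Fin n → Bool) → ∣ tabulate f ∣ ≡ sum (λ i → if f i then 1 else 0)
∣tabulate∣≡sum {zero} f = refl
∣tabulate∣≡sum {suc n} f with f zero
... | true = cong suc (∣tabulate∣≡sum (f ∘ suc))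
... | false = ∣tabulate∣≡sum (f ∘ suc)

∣toSubset∘π∣≡∣toSubset∣ : {P : Pred (Fin n) ℓ} (P? : Decidable P) (π : Permutation′ n) →
                          ∣ toSubset (P? ∘ (π ⟨$⟩ʳ_)) ∣ ≡ ∣ toSubset P? ∣
∣toSubset∘π∣≡∣toSubset∣ P? π = begin
  ∣ toSubset (P? ∘ (π ⟨$⟩ʳ_)) ∣  ≡⟨ ∣tabulate∣≡sum (does ∘ P? ∘ (π ⟨$⟩ʳ_)) ⟩
  sum (indicator ∘ (π ⟨$⟩ʳ_))    ≡⟨ sum-permute indicator π ⟨
  sum indicator                 ≡⟨ ∣tabulate∣≡sum (does ∘ P?) ⟨
  ∣ toSubset P? ∣                ∎
  where
  open ≡-Reasoning
  indicator : Fin _ → ℕ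
  indicator i = if does (P? i) then 1 else 0

SetwiseStabiliser : Pred (Fin n) 0ℓ → Pred (Sym n) 0ℓ
SetwiseStabiliser Y g = ∀ i → Y i ⇔ Y (g ⟨$⟩ʳ i)

module _ {Y : Pred (Fin n) 0ℓ} (Y? : Decidable Y) where
  open ≈-Reasoning (⇔-setoid 0ℓ)

  image : Sym n → Subset n
  image v = toSubset (Y? ∘ (v ⟨$⟩ˡ_))

  module E (v : Sym n) = Exchange (image v) (toSubset Y?)
    (∣p∣≡∣q∣⇒∣p─q∣≡∣q─p∣ (image v) (toSubset Y?) (∣toSubset∘π∣≡∣toSubset∣ Y? (v ⁻¹)))

  σ : Sym n → Sym n
  σ = E.exchangeₚ

  σ·v∈Stab : ∀ v → SetwiseStabiliser Y (σ v · v)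
  σ·v∈Stab v i = begin
    Y i                                ≡⟨ cong Y (inverseˡ v) ⟨
    Y (v ⟨$⟩ˡ (v ⟨$⟩ʳ i))              ≈⟨ ∈-toSubset (Y? ∘ (v ⟨$⟩ˡ_)) ⟨
    v ⟨$⟩ʳ i ∈ image v                 ≈⟨ E.∈X⇔exchange∈Y v ⟩
    σ v ⟨$⟩ʳ (v ⟨$⟩ʳ i) ∈ toSubset Y?  ≈⟨ ∈-toSubset Y? ⟩
    Y (σ v ⟨$⟩ʳ (v ⟨$⟩ʳ i))            ∎

  σ-unique : ∀ v w → SetwiseStabiliser Y (σ w · v) → σ v ≈ σ w
  σ-unique v w σw·v∈Stab = exchange-cong image-v≡image-w
    where
    same : x ∈ image v ⇔ x ∈ image w
    same {x = x} = begin
      x ∈ image v                      ≈⟨ ∈-toSubset (Y? ∘ (v ⟨$⟩ˡ_)) ⟩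
      Y (v ⟨$⟩ˡ x)                      ≈⟨ σw·v∈Stab (v ⟨$⟩ˡ x) ⟩
      Y (σ w ⟨$⟩ʳ (v ⟨$⟩ʳ (v ⟨$⟩ˡ x)))  ≡⟨ cong (Y ∘ (σ w ⟨$⟩ʳ_)) (inverseʳ v) ⟩
      Y (σ w ⟨$⟩ʳ x)                    ≈⟨ ∈-toSubset Y? ⟨
      σ w ⟨$⟩ʳ x ∈ toSubset Y?          ≈⟨ E.∈X⇔exchange∈Y w ⟨
      x ∈ image w                      ∎

    image-v≡image-w : image v ≡ image w
    image-v≡image-w = ⊆-antisym (Equivalence.to same) (Equivalence.from same)

  setwiseStabiliserTransversal : InvolutiveTransversal (SetwiseStabiliser Y)
  setwiseStabiliserTransversal = record
    { σ = σ
    ; σ-involutive = E.exchange-involutive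
    ; σ·v∈C = σ·v∈Stab
    ; σ-unique = σ-unique
    }

  setwiseStabiliser-isPerfectCode : IsPerfectCodeOf (SetwiseStabiliser Y)
  setwiseStabiliser-isPerfectCode = involutiveTransversal⇒perfectCode setwiseStabiliserTransversal
    λ g≈h g∈Stab i → subst (λ j → Y i ⇔ Y j) (g≈h i) (g∈Stab i)

proposition4p1 : (n m : ℕ) → 2 ≤ n → 1 ≤ m → m ≤ n ∸ 1 →
    IsPerfectCodeOf {n} (YoungSub {n} m)
proposition4p1 n m _ _ _ = setwiseStabiliser-isPerfectCode (λ i → toℕ i <? m)
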